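{- For every set of formulas $\Gamma\cup\{\alpha\}$: $\Gamma\vdash_{L_1^2}\alpha$ if and only if $\Gamma\vDash_{\mathcal{M}_1^2}\alpha$.
   Context: Formulas are built from propositional variables using unary $\neg,\circ$ and binary $\land,\lor,\to$; $\circ^{m+1}\alpha=\circ\circ^m\alpha$, $\alpha\leftrightarrow\beta:=(\alpha\to\beta)\land(\beta\to\alpha)$. Logics are Hilbert calculi with modus ponens as only rule and axiom schemas. mbC has the positive classical axioms $\alpha\to(\beta\to\alpha)$; $(\alpha\to\beta)\to((\alpha\to(\beta\to\gamma))\to(\alpha\to\gamma))$; $\alpha\to(\beta\to(\alpha\land\beta))$; $(\alpha\land\beta)\to\alpha$; $(\alpha\land\beta)\to\beta$; $\alpha\to(\alpha\lor\beta)$; $\beta\to(\alpha\lor\beta)$; $(\alpha\to\gamma)\to((\beta\to\gamma)\to((\alpha\lor\beta)\to\gamma))$; $\alpha\lor(\alpha\to\beta)$; plus $\alpha\lor\neg\alpha$ and $\circ\alpha\to(\alpha\to(\neg\alpha\to\beta))$. mbCciw = mbC + $\circ\alpha\lor(\alpha\land\neg\alpha)$. $L_1^0$ = mbCciw + $\circ\circ\circ\alpha$. $L_1^1$ = $L_1^0$ + $\neg\neg\alpha\to\alpha$ + $\alpha\to\neg\neg\alpha$. $L_1^2$ = $L_1^1$ + $\neg\circ\neg\alpha\leftrightarrow\neg\circ\alpha$. Nmatrix semantics: a valuation is a map $v$ from formulas into the domain with $v(\neg\alpha)\in\neg v(\alpha)$, $v(\circ\alpha)\in\circ v(\alpha)$,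 $v(\alpha\#\beta)\in v(\alpha)\#v(\beta)$; $\Gamma\vDash\alpha$ iff every valuation designating all of $\Gamma$ designates $\alpha$. $\mathcal{M}_1^2$: with Boolean $\land,\lor,\to,\sim$ on $\{0,1\}$, domain $\mathbb{B}_1^0=\{x\in\{0,1\}^3: x_1\lor x_2=1,\ x_3\lor\sim(x_1\land x_2)=1\}$; $x\#y=\{z\in\mathbb{B}_1^0: z_1=x_1\#y_1\}$ for $\#\in\{\land,\lor,\to\}$; $\neg x=\{(x_2,x_1,x_3)\}$; $\circ x=\{(\sim(x_1\land x_2),\,x_3,\,x_3\land\sim(x_1\land x_2))\}$; designated set $\{x\in\mathbb{B}_1^0:x_1=1\}$. -}

module Defs where

open import Data.Nat using (ℕ; zero; suc)
open import Data.Bool using (Bool; true; false; _∧_; _∨_; not)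
open import Data.Product using (_×_; _,_)
open import Relation.Binary.PropositionalEquality using (_≡_)
open import Level using (0ℓ)
open import Relation.Unary using (Pred)

infixr 5 _⇒_
infixl 6 _∨'_
infixl 7 _∧'_

data Formula : Set where
  var   : ℕ → Formula
  ¬'_   : Formula → Formula
  ∘'_   : Formula → Formula
  _∧'_  : Formula → Formula → Formula
  _∨'_  : Formula → Formula → Formula
  _⇒_   : Formula → Formula → Formula

∘^ : ℕ → Formula → Formula
∘^ zero    α = α
∘^ (suc m) α = ∘' (∘^ m α)

_⇔'_ : Formula → Formula → Formula
α ⇔' β = (α ⇒ β) ∧' (β ⇒ α)

-- Axiom schemas of L_1^2
--   mbC  (positive classical axioms, α ∨ ¬α, ∘α → (α → (¬α → β)))
--   + ciw : ∘α ∨ (α ∧ ¬α)               (mbCciw)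
--   + ∘∘∘α                              (L_1^0)
--   + ¬¬α → α, α → ¬¬α                  (L_1^1)
--   + ¬∘¬α ↔ ¬∘α                        (L_1^2)

data AxiomL12 : Formula → Set where
  ax1   : ∀ α β → AxiomL12 (α ⇒ (β ⇒ α))
  ax2   : ∀ α β γ → AxiomL12 ((α ⇒ β) ⇒ ((α ⇒ (β ⇒ γ)) ⇒ (α ⇒ γ)))
  ax3   : ∀ α β → AxiomL12 (α ⇒ (β ⇒ (α ∧' β)))
  ax4   : ∀ α β → AxiomL12 ((α ∧' β) ⇒ α)
  ax5   : ∀ α β → AxiomL12 ((α ∧' β) ⇒ β)
  ax6   : ∀ α β → AxiomL12 (α ⇒ (α ∨' β))
  ax7   : ∀ α β → AxiomL12 (β ⇒ (α ∨' β))
  ax8   : ∀ α β γ → AxiomL12 ((α ⇒ γ) ⇒ ((β ⇒ γ) ⇒ ((α ∨' β) ⇒ γ)))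
  ax9   : ∀ α β → AxiomL12 (α ∨' (α ⇒ β))
  ax10  : ∀ α → AxiomL12 (α ∨' (¬' α))
  bc1   : ∀ α β → AxiomL12 ((∘' α) ⇒ (α ⇒ ((¬' α) ⇒ β)))
  ciw   : ∀ α → AxiomL12 ((∘' α) ∨' (α ∧' (¬' α)))
  ooo   : ∀ α → AxiomL12 (∘^ 3 α)
  cf    : ∀ α → AxiomL12 ((¬' (¬' α)) ⇒ α)
  ce    : ∀ α → AxiomL12 (α ⇒ (¬' (¬' α)))
  neg∘  : ∀ α → AxiomL12 ((¬' (∘' (¬' α))) ⇔' (¬' (∘' α)))

infix 4 _⊢_
data _⊢_ (Γ : Pred Formula 0ℓ) : Formula → Set where
  hyp : ∀ {α} → Γ α → Γ ⊢ α
  ax  : ∀ {α} → AxiomL12 α → Γ ⊢ α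
  mp  : ∀ {α β} → Γ ⊢ α → Γ ⊢ (α ⇒ β) → Γ ⊢ β

record B10 : Set where
  constructor mkB
  field
    x₁ x₂ x₃ : Bool
    c₁ : (x₁ ∨ x₂) ≡ true
    c₂ : (x₃ ∨ not (x₁ ∧ x₂)) ≡ true
open B10 public

Designated : B10 → Set
Designated x = x₁ x ≡ true

_∈∧_,_ : B10 → B10 → B10 → Set
z ∈∧ x , y = x₁ z ≡ (x₁ x ∧ x₁ y)

_∈∨_,_ : B10 → B10 → B10 → Set
z ∈∨ x , y = x₁ z ≡ (x₁ x ∨ x₁ y)

_∈→_,_ : B10 → B10 → B10 → Set
z ∈→ x , y = x₁ z ≡ (not (x₁ x) ∨ x₁ y)

_∈¬_ : B10 → B10 → Set
z ∈¬ x = (x₁ z ≡ x₂ x) × (x₂ z ≡ x₁ x) × (x₃ z ≡ x₃ x)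

_∈∘_ : B10 → B10 → Set
z ∈∘ x = (x₁ z ≡ not (x₁ x ∧ x₂ x)) × (x₂ z ≡ x₃ x)
         × (x₃ z ≡ (x₃ x ∧ not (x₁ x ∧ x₂ x)))

record Valuation : Set where
  field
    v    : Formula → B10
    v-¬  : ∀ α → v (¬' α) ∈¬ v α
    v-∘  : ∀ α → v (∘' α) ∈∘ v α
    v-∧  : ∀ α β → v (α ∧' β) ∈∧ v α , v β
    v-∨  : ∀ α β → v (α ∨' β) ∈∨ v α , v β
    v-→  : ∀ α β → v (α ⇒ β) ∈→ v α , v β
open Valuation public

infix 4 _⊨_
_⊨_ : Pred Formula 0ℓ → Formula → Set
Γ ⊨ α = (val : Valuation) → (∀ β → Γ β → Designated (v val β)) → Designated (v val α)

-- The value v α of a valuation is (b α, b ¬α, b ¬∘α) with b = x₁ ∘ v, so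
-- valuations correspond to bivaluations b: Boolean functions on formulas that
-- are classical on ∧ ∨ →, satisfy b α ∨ b ¬α and b ∘α = ~(b α ∧ b ¬α), and
-- commute with ¬¬, ¬∘¬ and ¬∘∘ as the axioms cf/ce, ¬∘¬α ↔ ¬∘α and ∘∘∘α
-- require.  Soundness is the check that every bivaluation satisfies the
-- axioms.  For completeness, if Γ ⊬ α then Γ extends (Lindenbaum, using
-- excluded middle and a coding of formulas by numbers) to a theory maximal
-- among those not deriving α, whose characteristic function is a bivaluation.
module Submission where

open import Defs
open import Level using (0ℓ)
open import Relation.Unary using (Pred; _⊆_; _∪_; ｛_｝; ⋃)
open import Function using (id; _∘_)
open import Function.Bundles using (_⇔_; mk⇔; Equivalence)
open import Axiom.ExcludedMiddle using (ExcludedMiddle)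
open import Data.Nat using (ℕ; zero; suc; _+_; _*_; _≤′_; ≤′-refl; ≤′-step)
open import Data.Nat.Properties using (suc-injective; *-cancelˡ-≡; even≢odd; m≤′m+n; n≤′m+n)
open import Data.Bool using (Bool; true; false; _∧_; _∨_; not)
open import Data.Bool.Properties using (∧-comm; ∨-comm) renaming (_≟_ to _≟ᵇ_)
open import Data.Product using (∃-syntax; _×_; _,_; proj₁; proj₂; map₁; uncurry)
open import Data.Sum using (_⊎_; inj₁; inj₂; [_,_]; map₂)
open import Data.Empty using (⊥)
open import Relation.Nullary using (¬_; Dec; yes; no; does; contradiction)
open import Relation.Nullary.Decidable using (_×-dec_; _⊎-dec_; _→-dec_; ¬?; dec-true; dec-false; does-⇔)
open import Relation.Binary.PropositionalEquality using (_≡_; refl; sym; trans; cong; cong₂; module ≡-Reasoning)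

open Equivalence using (to; from)

∧-≡-true : ∀ {x y} → x ∧ y ≡ true ⇔ (x ≡ true × y ≡ true)
∧-≡-true {true}  = mk⇔ (refl ,_) proj₂
∧-≡-true {false} = mk⇔ (λ ()) (λ ())

∨-≡-true : ∀ {x y} → x ∨ y ≡ true ⇔ (x ≡ true ⊎ y ≡ true)
∨-≡-true {true}          = mk⇔ inj₁ (λ _ → refl)
∨-≡-true {false} {true}  = mk⇔ inj₂ (λ _ → refl)
∨-≡-true {false} {false} = mk⇔ (λ ()) [ (λ ()) , (λ ()) ]

→-≡-true : ∀ {x y} → not x ∨ y ≡ true ⇔ (x ≡ true → y ≡ true)
→-≡-true {true}  = mk⇔ (λ y _ → y) (λ f → f refl)
→-≡-true {false} = mk⇔ (λ _ ()) (λ _ → refl)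

nand-≡-true : ∀ {x y} → not (x ∧ y) ≡ true ⇔ (¬ (x ≡ true × y ≡ true))
nand-≡-true {true}  {true}  = mk⇔ (λ ()) (λ n → contradiction (refl , refl) n)
nand-≡-true {true}  {false} = mk⇔ (λ _ ()) (λ _ → refl)
nand-≡-true {false}         = mk⇔ (λ _ ()) (λ _ → refl)

record Bivaluation : Set where
  field
    b     : Formula → Bool
    b-∧   : ∀ α β → b (α ∧' β) ≡ b α ∧ b β
    b-∨   : ∀ α β → b (α ∨' β) ≡ b α ∨ b β
    b-→   : ∀ α β → b (α ⇒ β) ≡ not (b α) ∨ b β
    b-¬   : ∀ α → b α ∨ b (¬' α) ≡ true
    b-∘   : ∀ α → b (∘' α) ≡ not (b α ∧ b (¬' α))
    b-¬¬  : ∀ α → b (¬' ¬' α) ≡ b α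
    b-¬∘¬ : ∀ α → b (¬' ∘' ¬' α) ≡ b (¬' ∘' α)
    b-¬∘∘ : ∀ α → b (¬' ∘' ∘' α) ≡ b (∘' α) ∧ b (¬' ∘' α)

module BivaluationProperties (B : Bivaluation) where
  open Bivaluation B

  ∧-true : ∀ {α β} → b (α ∧' β) ≡ true ⇔ (b α ≡ true × b β ≡ true)
  ∧-true {α} {β} rewrite b-∧ α β = ∧-≡-true

  ∨-true : ∀ {α β} → b (α ∨' β) ≡ true ⇔ (b α ≡ true ⊎ b β ≡ true)
  ∨-true {α} {β} rewrite b-∨ α β = ∨-≡-true

  →-true : ∀ {α β} → b (α ⇒ β) ≡ true ⇔ (b α ≡ true → b β ≡ true)
  →-true {α} {β} rewrite b-→ α β = →-≡-true

  ∘-true : ∀ {α} → b (∘' α) ≡ true ⇔ (¬ (b α ≡ true × b (¬' α) ≡ true))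
  ∘-true {α} rewrite b-∘ α = nand-≡-true

  axiom-true : ∀ {φ} → AxiomL12 φ → b φ ≡ true
  axiom-true (ax1 α β)   = from →-true λ a → from →-true λ _ → a
  axiom-true (ax2 α β γ) = from →-true λ f → from →-true λ g → from →-true λ a →
                             to →-true (to →-true g a) (to →-true f a)
  axiom-true (ax3 α β)   = from →-true λ a → from →-true λ c → from ∧-true (a , c)
  axiom-true (ax4 α β)   = from →-true (proj₁ ∘ to ∧-true)
  axiom-true (ax5 α β)   = from →-true (proj₂ ∘ to ∧-true)
  axiom-true (ax6 α β)   = from →-true (from ∨-true ∘ inj₁)
  axiom-true (ax7 α β)   = from →-true (from ∨-true ∘ inj₂)
  axiom-true (ax8 α β γ) = from →-true λ f → from →-true λ g → from →-true λ a∨c →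
                             [ to →-true f , to →-true g ] (to ∨-true a∨c)
  axiom-true (ax9 α β) with b α ≟ᵇ true
  ... | yes a = from ∨-true (inj₁ a)
  ... | no ¬a = from ∨-true (inj₂ (from →-true λ a → contradiction a ¬a))
  axiom-true (ax10 α)    = trans (b-∨ α (¬' α)) (b-¬ α)
  axiom-true (bc1 α β)   = from →-true λ o → from →-true λ a → from →-true λ n →
                             contradiction (a , n) (to ∘-true o)
  axiom-true (ciw α) with (b α ≟ᵇ true) ×-dec (b (¬' α) ≟ᵇ true)
  ... | yes a∧n = from ∨-true (inj₂ (from ∧-true a∧n))
  ... | no ¬a∧n = from ∨-true (inj₁ (from ∘-true ¬a∧n))
  axiom-true (ooo α)     = from ∘-true λ (o , n) →
                             to ∘-true o (to ∧-≡-true (trans (sym (b-¬∘∘ α)) n))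
  axiom-true (cf α)      = from →-true (trans (sym (b-¬¬ α)))
  axiom-true (ce α)      = from →-true (trans (b-¬¬ α))
  axiom-true (neg∘ α)    = from ∧-true ( from →-true (trans (sym (b-¬∘¬ α)))
                                       , from →-true (trans (b-¬∘¬ α)))

  sound : ∀ {Γ φ} → Γ ⊢ φ → (∀ β → Γ β → b β ≡ true) → b φ ≡ true
  sound (hyp {φ} Γφ) Γ-true = Γ-true φ Γφ
  sound (ax a)       _      = axiom-true a
  sound (mp d e)     Γ-true = to →-true (sound e Γ-true) (sound d Γ-true)

bivaluation : Valuation → Bivaluation
bivaluation val = record
  { b     = b
  ; b-∧   = v-∧ val
  ; b-∨   = v-∨ val
  ; b-→   = v-→ val
  ; b-¬   = λ α → trans (cong (b α ∨_) (x₁-¬ α)) (c₁ (v val α))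
  ; b-∘   = λ α → trans (x₁-∘ α) (cong (λ y → not (b α ∧ y)) (sym (x₁-¬ α)))
  ; b-¬¬  = λ α → trans (x₁-¬ (¬' α)) (x₂-¬ α)
  ; b-¬∘¬ = b-¬∘¬
  ; b-¬∘∘ = b-¬∘∘
  }
  where
    open ≡-Reasoning

    b : Formula → Bool
    b α = x₁ (v val α)

    x₁-¬ : ∀ α → b (¬' α) ≡ x₂ (v val α)
    x₁-¬ α = proj₁ (v-¬ val α)

    x₂-¬ : ∀ α → x₂ (v val (¬' α)) ≡ b α
    x₂-¬ α = proj₁ (proj₂ (v-¬ val α))

    x₃-¬ : ∀ α → x₃ (v val (¬' α)) ≡ x₃ (v val α)
    x₃-¬ α = proj₂ (proj₂ (v-¬ val α))

    x₁-∘ : ∀ α → b (∘' α) ≡ not (b α ∧ x₂ (v val α))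
    x₁-∘ α = proj₁ (v-∘ val α)

    x₂-∘ : ∀ α → x₂ (v val (∘' α)) ≡ x₃ (v val α)
    x₂-∘ α = proj₁ (proj₂ (v-∘ val α))

    x₃-∘ : ∀ α → x₃ (v val (∘' α)) ≡ x₃ (v val α) ∧ not (b α ∧ x₂ (v val α))
    x₃-∘ α = proj₂ (proj₂ (v-∘ val α))

    b-¬∘¬ : ∀ α → b (¬' ∘' ¬' α) ≡ b (¬' ∘' α)
    b-¬∘¬ α = begin
      b (¬' ∘' ¬' α)       ≡⟨ x₁-¬ (∘' ¬' α) ⟩
      x₂ (v val (∘' ¬' α)) ≡⟨ x₂-∘ (¬' α) ⟩
      x₃ (v val (¬' α))    ≡⟨ x₃-¬ α ⟩
      x₃ (v val α)         ≡⟨ sym (x₂-∘ α) ⟩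
      x₂ (v val (∘' α))    ≡⟨ sym (x₁-¬ (∘' α)) ⟩
      b (¬' ∘' α)          ∎

    b-¬∘∘ : ∀ α → b (¬' ∘' ∘' α) ≡ b (∘' α) ∧ b (¬' ∘' α)
    b-¬∘∘ α = begin
      b (¬' ∘' ∘' α)                          ≡⟨ x₁-¬ (∘' ∘' α) ⟩
      x₂ (v val (∘' ∘' α))                    ≡⟨ x₂-∘ (∘' α) ⟩
      x₃ (v val (∘' α))                       ≡⟨ x₃-∘ α ⟩
      x₃ (v val α) ∧ not (b α ∧ x₂ (v val α)) ≡⟨ cong₂ _∧_ (sym (x₂-∘ α)) (sym (x₁-∘ α)) ⟩
      x₂ (v val (∘' α)) ∧ b (∘' α)            ≡⟨ cong (_∧ b (∘' α)) (sym (x₁-¬ (∘' α))) ⟩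
      b (¬' ∘' α) ∧ b (∘' α)                  ≡⟨ ∧-comm (b (¬' ∘' α)) (b (∘' α)) ⟩
      b (∘' α) ∧ b (¬' ∘' α)                  ∎

valuation : Bivaluation → Valuation
valuation B = record
  { v   = value
  ; v-¬ = λ α → refl , b-¬¬ α , b-¬∘¬ α
  ; v-∘ = λ α → b-∘ α , refl , x₃-∘ α
  ; v-∧ = b-∧
  ; v-∨ = b-∨
  ; v-→ = b-→
  }
  where
    open Bivaluation B
    open ≡-Reasoning

    ¬∘-or-consistent : ∀ α → b (¬' ∘' α) ∨ not (b α ∧ b (¬' α)) ≡ true
    ¬∘-or-consistent α = begin
      b (¬' ∘' α) ∨ not (b α ∧ b (¬' α)) ≡⟨ cong (b (¬' ∘' α) ∨_) (sym (b-∘ α)) ⟩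
      b (¬' ∘' α) ∨ b (∘' α)             ≡⟨ ∨-comm (b (¬' ∘' α)) (b (∘' α)) ⟩
      b (∘' α) ∨ b (¬' ∘' α)             ≡⟨ b-¬ (∘' α) ⟩
      true                               ∎

    value : Formula → B10
    value α = mkB (b α) (b (¬' α)) (b (¬' ∘' α)) (b-¬ α) (¬∘-or-consistent α)

    x₃-∘ : ∀ α → b (¬' ∘' ∘' α) ≡ b (¬' ∘' α) ∧ not (b α ∧ b (¬' α))
    x₃-∘ α = begin
      b (¬' ∘' ∘' α)                     ≡⟨ b-¬∘∘ α ⟩
      b (∘' α) ∧ b (¬' ∘' α)             ≡⟨ ∧-comm (b (∘' α)) (b (¬' ∘' α)) ⟩
      b (¬' ∘' α) ∧ b (∘' α)             ≡⟨ cong (b (¬' ∘' α) ∧_) (b-∘ α) ⟩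
      b (¬' ∘' α) ∧ not (b α ∧ b (¬' α)) ∎

⊢-mono : ∀ {Θ Θ′ φ} → Θ ⊆ Θ′ → Θ ⊢ φ → Θ′ ⊢ φ
⊢-mono Θ⊆Θ′ (hyp Θφ) = hyp (Θ⊆Θ′ Θφ)
⊢-mono Θ⊆Θ′ (ax a)   = ax a
⊢-mono Θ⊆Θ′ (mp d e) = mp (⊢-mono Θ⊆Θ′ d) (⊢-mono Θ⊆Θ′ e)

⇒-refl : ∀ {Θ} ψ → Θ ⊢ ψ ⇒ ψ
⇒-refl ψ = mp (ax (ax1 ψ (ψ ⇒ ψ))) (mp (ax (ax1 ψ ψ)) (ax (ax2 ψ (ψ ⇒ ψ) ψ)))

deduction : ∀ {Θ ψ φ} → Θ ∪ ｛ ψ ｝ ⊢ φ → Θ ⊢ ψ ⇒ φ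
deduction         (hyp (inj₁ Θφ))   = mp (hyp Θφ) (ax (ax1 _ _))
deduction {ψ = ψ} (hyp (inj₂ refl)) = ⇒-refl ψ
deduction         (ax a)            = mp (ax a) (ax (ax1 _ _))
deduction {ψ = ψ} (mp {α} {β} d e)  = mp (deduction e) (mp (deduction d) (ax (ax2 ψ α β)))

module Chain (Δ : ℕ → Pred Formula 0ℓ) (Δ-step : ∀ n → Δ n ⊆ Δ (suc n)) where

  Δ-mono : ∀ {m n} → m ≤′ n → Δ m ⊆ Δ n
  Δ-mono ≤′-refl         Δmφ = Δmφ
  Δ-mono (≤′-step m≤′n) Δmφ = Δ-step _ (Δ-mono m≤′n Δmφ)

  ⊢-⋃-compact : ∀ {φ} → ⋃ ℕ Δ ⊢ φ → ∃[ n ] Δ n ⊢ φ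
  ⊢-⋃-compact (hyp (n , Δnφ)) = n , hyp Δnφ
  ⊢-⋃-compact (ax a)          = 0 , ax a
  ⊢-⋃-compact (mp d e) with ⊢-⋃-compact d | ⊢-⋃-compact e
  ... | m , d′ | n , e′ =
    m + n , mp (⊢-mono (Δ-mono (m≤′m+n m n)) d′) (⊢-mono (Δ-mono (n≤′m+n m n)) e′)

record RelativelyMaximal (α : Formula) (Θ : Pred Formula 0ℓ) : Set where
  field
    ⊬α      : ¬ (Θ ⊢ α)
    maximal : ∀ ψ → Θ ψ ⊎ (Θ ∪ ｛ ψ ｝ ⊢ α)

module RelativelyMaximalTheory {α Θ} (Θ-max : RelativelyMaximal α Θ) where
  open RelativelyMaximal Θ-max

  α∉Θ : ¬ Θ α
  α∉Θ = ⊬α ∘ hyp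

  closed : ∀ {φ} → Θ ⊢ φ → Θ φ
  closed {φ} ⊢φ = [ id , (λ ⊢α → contradiction (mp ⊢φ (deduction ⊢α)) ⊬α) ] (maximal φ)

  axiom : ∀ {φ} → AxiomL12 φ → Θ φ
  axiom = closed ∘ ax

  modus-ponens : ∀ {φ ψ} → Θ φ → Θ (φ ⇒ ψ) → Θ ψ
  modus-ponens Θφ Θφ⇒ψ = closed (mp (hyp Θφ) (hyp Θφ⇒ψ))

  prime : ∀ {φ ψ} → Θ (φ ∨' ψ) → Θ φ ⊎ Θ ψ
  prime {φ} {ψ} Θφ∨ψ with maximal φ | maximal ψ
  ... | inj₁ Θφ  | _        = inj₁ Θφ
  ... | inj₂ _   | inj₁ Θψ  = inj₂ Θψ
  ... | inj₂ φ⊢α | inj₂ ψ⊢α =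
    contradiction (mp (hyp Θφ∨ψ) (mp (deduction ψ⊢α) (mp (deduction φ⊢α) (ax (ax8 φ ψ α))))) ⊬α

  ∧-member : ∀ {φ ψ} → Θ (φ ∧' ψ) ⇔ (Θ φ × Θ ψ)
  ∧-member {φ} {ψ} = mk⇔
    (λ Θφ∧ψ → modus-ponens Θφ∧ψ (axiom (ax4 φ ψ)) , modus-ponens Θφ∧ψ (axiom (ax5 φ ψ)))
    (λ (Θφ , Θψ) → modus-ponens Θψ (modus-ponens Θφ (axiom (ax3 φ ψ))))

  ∨-member : ∀ {φ ψ} → Θ (φ ∨' ψ) ⇔ (Θ φ ⊎ Θ ψ)
  ∨-member {φ} {ψ} = mk⇔ prime
    [ (λ Θφ → modus-ponens Θφ (axiom (ax6 φ ψ))) , (λ Θψ → modus-ponens Θψ (axiom (ax7 φ ψ))) ]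

  ⇒-member : ∀ {φ ψ} → Θ (φ ⇒ ψ) ⇔ (Θ φ → Θ ψ)
  ⇒-member {φ} {ψ} = mk⇔ (λ Θφ⇒ψ Θφ → modus-ponens Θφ Θφ⇒ψ)
    (λ f → [ (λ Θφ → modus-ponens (f Θφ) (axiom (ax1 ψ φ))) , id ] (prime (axiom (ax9 φ ψ))))

  excluded : ∀ φ → Θ φ ⊎ Θ (¬' φ)
  excluded φ = prime (axiom (ax10 φ))

  explosive : ∀ {φ} → Θ (∘' φ) → Θ φ → Θ (¬' φ) → ⊥
  explosive {φ} Θ∘φ Θφ Θ¬φ =
    α∉Θ (modus-ponens Θ¬φ (modus-ponens Θφ (modus-ponens Θ∘φ (axiom (bc1 φ α)))))

  consistent-or-contradictory : ∀ φ → Θ (∘' φ) ⊎ (Θ φ × Θ (¬' φ))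
  consistent-or-contradictory φ = map₂ (to ∧-member) (prime (axiom (ciw φ)))

  ∘-member : ∀ {φ} → Θ (∘' φ) ⇔ (¬ (Θ φ × Θ (¬' φ)))
  ∘-member {φ} = mk⇔ (λ Θ∘φ → uncurry (explosive Θ∘φ))
    (λ ¬contra → [ id , (λ contra → contradiction contra ¬contra) ] (consistent-or-contradictory φ))

  ¬¬-member : ∀ {φ} → Θ (¬' ¬' φ) ⇔ Θ φ
  ¬¬-member {φ} = mk⇔ (λ Θ¬¬φ → modus-ponens Θ¬¬φ (axiom (cf φ)))
                      (λ Θφ → modus-ponens Θφ (axiom (ce φ)))

  ¬∘¬-member : ∀ {φ} → Θ (¬' ∘' ¬' φ) ⇔ Θ (¬' ∘' φ)
  ¬∘¬-member {φ} = mk⇔ (to ⇒-member (proj₁ (to ∧-member (axiom (neg∘ φ)))))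
                       (to ⇒-member (proj₂ (to ∧-member (axiom (neg∘ φ)))))

  ¬∘∘-member : ∀ {φ} → Θ (¬' ∘' ∘' φ) ⇔ (Θ (∘' φ) × Θ (¬' ∘' φ))
  ¬∘∘-member {φ} = mk⇔
    (λ Θ¬∘∘φ → [ (λ Θ∘∘φ → contradiction Θ¬∘∘φ (explosive (axiom (ooo φ)) Θ∘∘φ)) , id ]
                 (consistent-or-contradictory (∘' φ)))
    (λ contra → [ (λ Θ∘∘φ → contradiction contra (to ∘-member Θ∘∘φ)) , id ]
                  (excluded (∘' ∘' φ)))

  characteristic : ExcludedMiddle 0ℓ → Bivaluation
  characteristic em = record
    { b     = λ φ → does (Θ? φ)
    ; b-∧   = λ φ ψ → does-⇔ ∧-member (Θ? (φ ∧' ψ)) (Θ? φ ×-dec Θ? ψ)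
    ; b-∨   = λ φ ψ → does-⇔ ∨-member (Θ? (φ ∨' ψ)) (Θ? φ ⊎-dec Θ? ψ)
    ; b-→   = λ φ ψ → does-⇔ ⇒-member (Θ? (φ ⇒ ψ)) (Θ? φ →-dec Θ? ψ)
    ; b-¬   = λ φ → dec-true (Θ? φ ⊎-dec Θ? (¬' φ)) (excluded φ)
    ; b-∘   = λ φ → does-⇔ ∘-member (Θ? (∘' φ)) (¬? (Θ? φ ×-dec Θ? (¬' φ)))
    ; b-¬¬  = λ φ → does-⇔ ¬¬-member (Θ? (¬' ¬' φ)) (Θ? φ)
    ; b-¬∘¬ = λ φ → does-⇔ ¬∘¬-member (Θ? (¬' ∘' ¬' φ)) (Θ? (¬' ∘' φ))
    ; b-¬∘∘ = λ φ → does-⇔ ¬∘∘-member (Θ? (¬' ∘' ∘' φ)) (Θ? (∘' φ) ×-dec Θ? (¬' ∘' φ))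
    }
    where
      Θ? : ∀ φ → Dec (Θ φ)
      Θ? φ = em

pair : ℕ → ℕ → ℕ
pair zero    n = suc (2 * n)
pair (suc m) n = 2 * pair m n

pair-injective : ∀ m n m′ n′ → pair m n ≡ pair m′ n′ → m ≡ m′ × n ≡ n′
pair-injective zero    n zero     n′ e = refl , *-cancelˡ-≡ n n′ 2 (suc-injective e)
pair-injective zero    n (suc m′) n′ e = contradiction (sym e) (even≢odd (pair m′ n′) n)
pair-injective (suc m) n zero     n′ e = contradiction e (even≢odd (pair m n) n′)
pair-injective (suc m) n (suc m′) n′ e =
  map₁ (cong suc) (pair-injective m n m′ n′ (*-cancelˡ-≡ (pair m n) (pair m′ n′) 2 e))

tag : Formula → ℕ
tag (var _)  = 0
tag (¬' _)   = 1
tag (∘' _)   = 2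
tag (_ ∧' _) = 3
tag (_ ∨' _) = 4
tag (_ ⇒ _)  = 5

mutual
  code : Formula → ℕ
  code φ = pair (tag φ) (arguments φ)

  arguments : Formula → ℕ
  arguments (var n)  = n
  arguments (¬' φ)   = code φ
  arguments (∘' φ)   = code φ
  arguments (φ ∧' ψ) = pair (code φ) (code ψ)
  arguments (φ ∨' ψ) = pair (code φ) (code ψ)
  arguments (φ ⇒ ψ)  = pair (code φ) (code ψ)

mutual
  code-injective : ∀ φ ψ → code φ ≡ code ψ → φ ≡ ψ
  code-injective φ ψ e =
    ≡-from-parts φ ψ (pair-injective (tag φ) (arguments φ) (tag ψ) (arguments ψ) e)

  ≡-from-parts : ∀ φ ψ → tag φ ≡ tag ψ × arguments φ ≡ arguments ψ → φ ≡ ψ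
  ≡-from-parts (var m)   (var n)   (refl , e) = cong var e
  ≡-from-parts (¬' φ)    (¬' ψ)    (refl , e) = cong ¬'_ (code-injective φ ψ e)
  ≡-from-parts (∘' φ)    (∘' ψ)    (refl , e) = cong ∘'_ (code-injective φ ψ e)
  ≡-from-parts (φ ∧' φ′) (ψ ∧' ψ′) (refl , e) = uncurry (cong₂ _∧'_) (code-injective₂ φ φ′ ψ ψ′ e)
  ≡-from-parts (φ ∨' φ′) (ψ ∨' ψ′) (refl , e) = uncurry (cong₂ _∨'_) (code-injective₂ φ φ′ ψ ψ′ e)
  ≡-from-parts (φ ⇒ φ′)  (ψ ⇒ ψ′)  (refl , e) = uncurry (cong₂ _⇒_) (code-injective₂ φ φ′ ψ ψ′ e)

  code-injective₂ : ∀ φ φ′ ψ ψ′ → pair (code φ) (code φ′) ≡ pair (code ψ) (code ψ′) → φ ≡ ψ × φ′ ≡ ψ′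
  code-injective₂ φ φ′ ψ ψ′ e =
    let (p , q) = pair-injective (code φ) (code φ′) (code ψ) (code ψ′) e
    in code-injective φ ψ p , code-injective φ′ ψ′ q

module Lindenbaum (em : ExcludedMiddle 0ℓ) {Γ α} (Γ⊬α : ¬ (Γ ⊢ α)) where

  stage : ℕ → Pred Formula 0ℓ
  stage zero      = Γ
  stage (suc n) ψ = stage n ψ ⊎ (code ψ ≡ n × ¬ (stage n ∪ ｛ ψ ｝ ⊢ α))

  stage-⊬ : ∀ n → ¬ (stage n ⊢ α)
  stage-⊬ zero = Γ⊬α
  stage-⊬ (suc n) ⊢α with em {∃[ ψ ] (code ψ ≡ n × ¬ (stage n ∪ ｛ ψ ｝ ⊢ α))}
  ... | yes (ψ , code≡n , ψ⊬α) = ψ⊬α (⊢-mono only-ψ-added ⊢α)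
    where
      only-ψ-added : stage (suc n) ⊆ stage n ∪ ｛ ψ ｝
      only-ψ-added     (inj₁ old)              = inj₁ old
      only-ψ-added {χ} (inj₂ (code≡n′ , _)) = inj₂ (code-injective ψ χ (trans code≡n (sym code≡n′)))
  ... | no nothing-added = stage-⊬ n (⊢-mono nothing-new ⊢α)
    where
      nothing-new : stage (suc n) ⊆ stage n
      nothing-new (inj₁ old)   = old
      nothing-new (inj₂ added) = contradiction (_ , added) nothing-added

  open Chain stage (λ _ → inj₁)

  limit : Pred Formula 0ℓ
  limit = ⋃ ℕ stage

  Γ⊆limit : Γ ⊆ limit
  Γ⊆limit Γφ = 0 , Γφ

  limit-relativelyMaximal : RelativelyMaximal α limit
  limit-relativelyMaximal = record { ⊬α = limit-⊬ ; maximal = limit-maximal }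
    where
      limit-⊬ : ¬ (limit ⊢ α)
      limit-⊬ ⊢α = let (n , stage⊢α) = ⊢-⋃-compact ⊢α in stage-⊬ n stage⊢α

      limit-maximal : ∀ ψ → limit ψ ⊎ (limit ∪ ｛ ψ ｝ ⊢ α)
      limit-maximal ψ with em {stage (code ψ) ∪ ｛ ψ ｝ ⊢ α}
      ... | yes ⊢α = inj₂ (⊢-mono (Data.Sum.map₁ (code ψ ,_)) ⊢α)
      ... | no  ⊬α = inj₁ (suc (code ψ) , inj₂ (refl , ⊬α))

complete : ExcludedMiddle 0ℓ → ∀ {Γ α} → Γ ⊨ α → Γ ⊢ α
complete em {Γ} {α} ⊨α with em {Γ ⊢ α}
... | yes ⊢α = ⊢α
... | no  ⊬α = contradiction (⊨α (valuation B) Γ-designated) α-undesignated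
  where
    open Lindenbaum em ⊬α
    open RelativelyMaximalTheory limit-relativelyMaximal
    B : Bivaluation
    B = characteristic em

    Γ-designated : ∀ β → Γ β → Designated (v (valuation B) β)
    Γ-designated β Γβ = dec-true em (Γ⊆limit Γβ)

    α-undesignated : ¬ Designated (v (valuation B) α)
    α-undesignated designated = contradiction (trans (sym designated) (dec-false em α∉Θ)) λ ()

theorem10 : ExcludedMiddle 0ℓ → (Γ : Pred Formula 0ℓ) (α : Formula) → (Γ ⊢ α) ⇔ (Γ ⊨ α)
theorem10 em Γ α = mk⇔ (λ ⊢α val → BivaluationProperties.sound (bivaluation val) ⊢α) (complete em)
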